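{- Let $i,j\in[n]$ with $i\ne j$, let $\mathcal A,\mathcal B\subseteq\{a_1,\dots,a_m\}$ with $|\mathcal A|=|\mathcal B|=k$, and let $S_1\in\mathcal G_{i,\mathcal A}$, $S_2\in\mathcal G_{j,\mathcal A}$, $T_1\in\mathcal G_{i,\mathcal B}$, $T_2\in\mathcal G_{j,\mathcal B}$. Suppose that (i) $S_1\ne S_2$ or $T_1\ne T_2$ or $V(S_1)\cap V(T_1)=\{i\}$, and (ii) every edge of $S_1\cup S_2\cup T_1\cup T_2$ belongs to at least two of $S_1,S_2,T_1,T_2$. Then $\mathcal E^{\mathrm u}(S_1)=\mathcal E^{\mathrm u}(T_1)$ and $\mathcal E^{\mathrm u}(S_2)=\mathcal E^{\mathrm u}(T_2)$.
   Context: Vertices are users $[n]$ and attributes $a_1,\dots,a_m$. For a user $r$ and a set $\mathcal A$ of $k$ attributes, $\mathcal G_{r,\mathcal A}$ is the set of trees consisting of $k$ paths $r-u_t-\alpha_t$ ($t=1,\dots,k$), with $u_1,\dots,u_k$ distinct users in $[n]\setminus\{r\}$ and $\{\alpha_1,\dots,\alpha_k\}=\mathcal A$. $V(S)$ is the vertex set of $S$ and $\mathcal E^{\mathrm u}(S)$ is its set of user–user edges. -}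

module Defs where

open import Data.Nat using (ℕ)
open import Data.Fin using (Fin)
open import Data.Fin.Subset using (Subset; _∈_)
open import Data.Sum using (_⊎_; inj₁; inj₂)
open import Data.Product using (Σ; ∃; ∃-syntax; _×_)
open import Data.Vec using (Vec; lookup; _∷_; [])
open import Relation.Binary.PropositionalEquality using (_≡_; _≢_)
open import Function.Definitions using (Injective)
open import Function.Bundles using (_⇔_)

-- Vertices: users Fin n (inj₁) and attributes Fin m (inj₂).
Vtx : ℕ → ℕ → Set
Vtx n m = Fin n ⊎ Fin m

Graph : ℕ → ℕ → Set₁
Graph n m = Vtx n m → Vtx n m → Set

TreeEdge : ∀ {n m k} → Fin n → (Fin k → Fin n) → (Fin k → Fin m) → Graph n m
TreeEdge {n} {m} {k} r u α x y =
  ∃[ t ] ( (x ≡ inj₁ r × y ≡ inj₁ (u t))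
         ⊎ (x ≡ inj₁ (u t) × y ≡ inj₁ r)
         ⊎ (x ≡ inj₁ (u t) × y ≡ inj₂ (α t))
         ⊎ (x ≡ inj₂ (α t) × y ≡ inj₁ (u t)) )

-- S ∈ 𝒢_{r,𝒜} (for 𝒜 a set of k attributes): S is the tree made of k paths
-- r - u_t - α_t with u_1..u_k distinct users ≠ r and {α_1..α_k} = 𝒜.
InG : ∀ {n m} (k : ℕ) → Fin n → Subset m → Graph n m → Set
InG {n} {m} k r A S =
  Σ (Fin k → Fin n) λ u → Σ (Fin k → Fin m) λ α →
    Injective _≡_ _≡_ u
    × (∀ t → u t ≢ r)
    × (∀ a → (a ∈ A) ⇔ (∃[ t ] α t ≡ a))
    × (∀ x y → S x y ⇔ TreeEdge r u α x y)

_≐_ : ∀ {n m} → Graph n m → Graph n m → Set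
S ≐ T = ∀ x y → S x y ⇔ T x y

VS : ∀ {n m} → Fin n → Graph n m → Vtx n m → Set
VS r S x = x ≡ inj₁ r ⊎ ∃[ y ] S x y

Eu : ∀ {n m} → Graph n m → Fin n → Fin n → Set
Eu S a b = S (inj₁ a) (inj₁ b)

AtLeastTwo : ∀ {n m} → Vec (Graph n m) 4 → Vtx n m → Vtx n m → Set
AtLeastTwo Gs x y = Σ (Fin 4) λ p → Σ (Fin 4) λ q → p ≢ q × lookup Gs p x y × lookup Gs q x y

InUnion : ∀ {n m} → Vec (Graph n m) 4 → Vtx n m → Vtx n m → Set
InUnion Gs x y = ∃[ p ] lookup Gs p x y

-- Take a branch user u of the tree S₁ rooted at i. The spoke {i, u} of S₁ lies in a second tree.
-- In a tree rooted at j ≠ i the only user–user edges at i are spokes {j, i}, so either u is a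
-- branch of T₁ (the other tree rooted at i) or u = j. In the latter case the edge from u to its
-- attribute must also be shared, yet trees rooted at j have no attribute edge at j, so it lies in
-- T₁ and again u is a branch of T₁. Hence S₁ and T₁ have the same branches, i.e. the same spokes,
-- which are their user–user edges; likewise for S₂ and T₂. Hypothesis (i), the cardinalities and
-- the distinctness of the branches are not needed.
module Submission where

open import Defs
open import Data.Nat using (ℕ)
open import Data.Fin using (Fin)
open import Data.Fin.Patterns using (0F; 1F; 2F; 3F)
open import Data.Fin.Properties using (_≟_)
open import Data.Fin.Subset using (Subset; ∣_∣)
open import Data.Sum using (_⊎_; inj₁; inj₂; [_,_])
import Data.Sum as Sum
open import Data.Product using (_×_; _,_; ∃-syntax)
import Data.Product as Product
open import Data.Vec using (Vec; lookup; _∷_; [])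
open import Data.Empty using (⊥-elim)
open import Function using (_∘_)
open import Function.Bundles using (_⇔_; mk⇔; Equivalence)
open import Relation.Binary.Core using (_⇒_)
open import Relation.Binary.Construct.Union using (_∪_)
open import Relation.Binary.PropositionalEquality using (_≡_; _≢_; refl; sym; subst)
open import Relation.Nullary using (¬_; yes; no)

open Equivalence using (to; from)

Branch : ∀ {n k} → (Fin k → Fin n) → Fin n → Set
Branch u b = ∃[ t ] u t ≡ b

Spoke : ∀ {n k} → Fin n → (Fin k → Fin n) → Fin n → Fin n → Set
Spoke r u a b = (a ≡ r × Branch u b) ⊎ (Branch u a × b ≡ r)

Spoke-mono : ∀ {n k l} {r : Fin n} {u : Fin k → Fin n} {v : Fin l → Fin n} →
  (∀ {b} → Branch u b → Branch v b) → Spoke r u ⇒ Spoke r v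
Spoke-mono u⊆v = Sum.map (Product.map₂ u⊆v) (Product.map₁ u⊆v)

module _ {n m k} {r : Fin n} {u : Fin k → Fin n} {α : Fin k → Fin m} where

  TreeEdge-user-user : ∀ {a b} → TreeEdge r u α (inj₁ a) (inj₁ b) ⇔ Spoke r u a b
  TreeEdge-user-user = mk⇔ classify build
    where
    classify : ∀ {a b} → TreeEdge r u α (inj₁ a) (inj₁ b) → Spoke r u a b
    classify (t , inj₁ (refl , refl))          = inj₁ (refl , t , refl)
    classify (t , inj₂ (inj₁ (refl , refl)))   = inj₂ ((t , refl) , refl)
    classify (t , inj₂ (inj₂ (inj₁ (_ , ()))))
    classify (t , inj₂ (inj₂ (inj₂ (() , _))))

    build : ∀ {a b} → Spoke r u a b → TreeEdge r u α (inj₁ a) (inj₁ b)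
    build (inj₁ (refl , t , refl))   = t , inj₁ (refl , refl)
    build (inj₂ ((t , refl) , refl)) = t , inj₂ (inj₁ (refl , refl))

  TreeEdge-user-attribute⇒Branch : ∀ {a c} → TreeEdge r u α (inj₁ a) (inj₂ c) → Branch u a
  TreeEdge-user-attribute⇒Branch (t , inj₁ (_ , ()))
  TreeEdge-user-attribute⇒Branch (t , inj₂ (inj₁ (_ , ())))
  TreeEdge-user-attribute⇒Branch (t , inj₂ (inj₂ (inj₁ (refl , _)))) = t , refl
  TreeEdge-user-attribute⇒Branch (t , inj₂ (inj₂ (inj₂ (() , _))))

  module _ (u≢r : ∀ t → u t ≢ r) where

    root-attribute-edge-absurd : ∀ {c} → ¬ TreeEdge r u α (inj₁ r) (inj₂ c)
    root-attribute-edge-absurd e with TreeEdge-user-attribute⇒Branch e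
    ... | t , ut≡r = u≢r t ut≡r

    root-edge⇒Branch : ∀ {b} → TreeEdge r u α (inj₁ r) (inj₁ b) → Branch u b
    root-edge⇒Branch e with to TreeEdge-user-user e
    ... | inj₁ (_ , branch)    = branch
    ... | inj₂ ((t , ut≡r) , _) = ⊥-elim (u≢r t ut≡r)

  foreign-user-edge⇒root : ∀ {r' b} → r' ≢ r → TreeEdge r u α (inj₁ r') (inj₁ b) → b ≡ r
  foreign-user-edge⇒root r'≢r e with to TreeEdge-user-user e
  ... | inj₁ (r'≡r , _) = ⊥-elim (r'≢r r'≡r)
  ... | inj₂ (_ , b≡r)  = b≡r

branches-shared : ∀ {n m k l} {r r' : Fin n} {u : Fin k → Fin n} {v : Fin l → Fin n}
  {α : Fin k → Fin m} {γ : Fin l → Fin m} {O : Graph n m} →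
  (∀ s → v s ≢ r) →
  (∀ {b} → O (inj₁ r) (inj₁ b) → b ≡ r') →
  (∀ {c} → ¬ O (inj₁ r') (inj₂ c)) →
  TreeEdge r u α ⇒ TreeEdge r v γ ∪ O →
  ∀ {b} → Branch u b → Branch v b
branches-shared {r = r} {u = u} {α = α} {O = O} v≢r O-root O-attribute cover (t , refl)
  with cover {inj₁ r} {inj₁ (u t)} (t , inj₁ (refl , refl))
... | inj₁ spoke = root-edge⇒Branch v≢r spoke
... | inj₂ spoke with cover {inj₁ (u t)} {inj₂ (α t)} (t , inj₂ (inj₂ (inj₁ (refl , refl))))
...   | inj₁ leaf = TreeEdge-user-attribute⇒Branch leaf
...   | inj₂ leaf = ⊥-elim (O-attribute (subst (λ b → O (inj₁ b) (inj₂ (α t))) (O-root spoke) leaf))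

Eu-equivalent : ∀ {n m k₁ k₂ k₃ k₄} {r r' : Fin n} {A B A' B' : Subset m} {S T S' T' : Graph n m} →
  r ≢ r' → InG k₁ r A S → InG k₂ r B T → InG k₃ r' A' S' → InG k₄ r' B' T' →
  S ⇒ T ∪ (S' ∪ T') → T ⇒ S ∪ (S' ∪ T') →
  ∀ a b → Eu S a b ⇔ Eu T a b
Eu-equivalent {r = r} {r'} {S = S} {T} {S'} {T'} r≢r'
  (u , α , _ , u≢r , _ , S≐) (v , γ , _ , v≢r , _ , T≐) (_ , _ , _ , w≢r' , _ , S'≐) (_ , _ , _ , x≢r' , _ , T'≐)
  S-cover T-cover a b =
  mk⇔ (from (T≐ _ _) ∘ from TreeEdge-user-user ∘ Spoke-mono u⊆v ∘ to TreeEdge-user-user ∘ to (S≐ _ _))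
      (from (S≐ _ _) ∘ from TreeEdge-user-user ∘ Spoke-mono v⊆u ∘ to TreeEdge-user-user ∘ to (T≐ _ _))
  where
  others-root : ∀ {b} → (S' ∪ T') (inj₁ r) (inj₁ b) → b ≡ r'
  others-root = [ foreign-user-edge⇒root r≢r' ∘ to (S'≐ _ _) , foreign-user-edge⇒root r≢r' ∘ to (T'≐ _ _) ]

  others-attribute : ∀ {c} → ¬ (S' ∪ T') (inj₁ r') (inj₂ c)
  others-attribute = [ root-attribute-edge-absurd w≢r' ∘ to (S'≐ _ _) , root-attribute-edge-absurd x≢r' ∘ to (T'≐ _ _) ]

  u⊆v : ∀ {b} → Branch u b → Branch v b
  u⊆v = branches-shared v≢r others-root others-attribute
          (Sum.map₁ (to (T≐ _ _)) ∘ S-cover ∘ from (S≐ _ _))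

  v⊆u : ∀ {b} → Branch v b → Branch u b
  v⊆u = branches-shared u≢r others-root others-attribute
          (Sum.map₁ (to (S≐ _ _)) ∘ T-cover ∘ from (T≐ _ _))

AtLeastTwo⇒another : ∀ {n m} (Gs : Vec (Graph n m) 4) {x y} p →
  AtLeastTwo Gs x y → ∃[ q ] q ≢ p × lookup Gs q x y
AtLeastTwo⇒another Gs p (p₁ , q₁ , p₁≢q₁ , G₁xy , G₂xy) with p₁ ≟ p
... | yes refl = q₁ , p₁≢q₁ ∘ sym , G₂xy
... | no p₁≢p  = p₁ , p₁≢p , G₁xy

shared-edges-covered : ∀ {n m} {S₁ S₂ T₁ T₂ : Graph n m} →
  let Gs = S₁ ∷ S₂ ∷ T₁ ∷ T₂ ∷ [] in
  (∀ x y → InUnion Gs x y → AtLeastTwo Gs x y) →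
  (S₁ ⇒ T₁ ∪ (S₂ ∪ T₂)) × (T₁ ⇒ S₁ ∪ (S₂ ∪ T₂)) ×
  (S₂ ⇒ T₂ ∪ (S₁ ∪ T₁)) × (T₂ ⇒ S₂ ∪ (S₁ ∪ T₁))
shared-edges-covered {S₁ = S₁} {S₂} {T₁} {T₂} two = S₁-cover , T₁-cover , S₂-cover , T₂-cover
  where
  Gs = S₁ ∷ S₂ ∷ T₁ ∷ T₂ ∷ []

  another : ∀ p {x y} → lookup Gs p x y → ∃[ q ] q ≢ p × lookup Gs q x y
  another p G = AtLeastTwo⇒another Gs p (two _ _ (p , G))

  S₁-cover : S₁ ⇒ T₁ ∪ (S₂ ∪ T₂)
  S₁-cover G with another 0F G
  ... | 0F , 0≢0 , _ = ⊥-elim (0≢0 refl)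
  ... | 1F , _ , H   = inj₂ (inj₁ H)
  ... | 2F , _ , H   = inj₁ H
  ... | 3F , _ , H   = inj₂ (inj₂ H)

  T₁-cover : T₁ ⇒ S₁ ∪ (S₂ ∪ T₂)
  T₁-cover G with another 2F G
  ... | 0F , _ , H   = inj₁ H
  ... | 1F , _ , H   = inj₂ (inj₁ H)
  ... | 2F , 2≢2 , _ = ⊥-elim (2≢2 refl)
  ... | 3F , _ , H   = inj₂ (inj₂ H)

  S₂-cover : S₂ ⇒ T₂ ∪ (S₁ ∪ T₁)
  S₂-cover G with another 1F G
  ... | 0F , _ , H   = inj₂ (inj₁ H)
  ... | 1F , 1≢1 , _ = ⊥-elim (1≢1 refl)
  ... | 2F , _ , H   = inj₂ (inj₂ H)
  ... | 3F , _ , H   = inj₁ H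

  T₂-cover : T₂ ⇒ S₂ ∪ (S₁ ∪ T₁)
  T₂-cover G with another 3F G
  ... | 0F , _ , H   = inj₂ (inj₁ H)
  ... | 1F , _ , H   = inj₁ H
  ... | 2F , _ , H   = inj₂ (inj₂ H)
  ... | 3F , 3≢3 , _ = ⊥-elim (3≢3 refl)

lemma4 : ∀ {n m k : ℕ} (i j : Fin n) → i ≢ j →
    (A B : Subset m) → ∣ A ∣ ≡ k → ∣ B ∣ ≡ k →
    (S₁ S₂ T₁ T₂ : Graph n m) →
    InG k i A S₁ → InG k j A S₂ → InG k i B T₁ → InG k j B T₂ →
    (¬ (S₁ ≐ S₂) ⊎ ¬ (T₁ ≐ T₂) ⊎ (∀ x → (VS i S₁ x × VS i T₁ x) ⇔ (x ≡ inj₁ i))) →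
    (∀ x y → InUnion (S₁ ∷ S₂ ∷ T₁ ∷ T₂ ∷ []) x y → AtLeastTwo (S₁ ∷ S₂ ∷ T₁ ∷ T₂ ∷ []) x y) →
    (∀ a b → Eu S₁ a b ⇔ Eu T₁ a b) × (∀ a b → Eu S₂ a b ⇔ Eu T₂ a b)
lemma4 i j i≢j _ _ _ _ _ _ _ _ S₁∈ S₂∈ T₁∈ T₂∈ _ two =
  let S₁-cover , T₁-cover , S₂-cover , T₂-cover = shared-edges-covered two in
  Eu-equivalent i≢j S₁∈ T₁∈ S₂∈ T₂∈ S₁-cover T₁-cover ,
  Eu-equivalent (i≢j ∘ sym) S₂∈ T₂∈ S₁∈ T₁∈ S₂-cover T₂-cover
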